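{- Let $S\subset \mathbb{Z}^n$ be a realizable set and let $(G,W)$ be a realization of $S$, where $G$ is regarded as a graph with vertex set $V(G)=S$ and $W=\{\omega^1,\dots,\omega^n\}$ is such that $r_G(u\mid W)=u$ for every $u\in S$. Let $xy\in E(G)$. Then $r_{G-xy}(u\mid W)=r_G(u\mid W)=(u_1,\dots,u_n)$ for every $u\in S$ if and only if the following holds: for every $i\in[n]$ with $x_i=y_i-1$ there exists $z\in N_G(y)\setminus\{x\}$ with $z_i=x_i$, and for every $i\in[n]$ with $y_i=x_i-1$ there exists $z\in N_G(x)\setminus\{y\}$ with $z_i=y_i$.
   Context: All graphs are finite, simple and connected (distances in $G-xy$ are graph distances, infinite if disconnected). For a graph $G$ and an ordered vertex subset $W=\{\omega^1,\dots,\omega^n\}$, $r_G(u\mid W)=(d_G(u,\omega^1),\dots,d_G(u,\omega^n))$. A finite set $S\subset\mathbb{Z}^n$ is realizable if there is a graph $G$ and a resolving set $W$ (i.e. $u\mapsto r_G(u\mid W)$ injective) with $S=\{r_G(u\mid W): u\in V(G)\}$; $(G,W)$ is then a realization of $S$, and it is identified with a graph on vertex set $S$ in which each vertex $u$ has representation $u$. $N_G(v)$ is the neighbourhood of $v$, and $G-xy$ is $G$ with the edge $xy$ removed. -}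

module Defs where

open import Data.Nat using (ℕ; zero; suc; _<_)
open import Data.Integer using (ℤ; +_; _-_)
open import Data.Fin using (Fin)
open import Data.Product using (Σ; ∃; _×_; _,_)
open import Data.Sum using (_⊎_)
open import Relation.Nullary using (¬_; Dec)
open import Relation.Binary.PropositionalEquality using (_≡_; _≢_)
open import Function.Definitions using (Injective)

record Graph (m : ℕ) : Set₁ where
  field
    Adj     : Fin m → Fin m → Set
    adj?    : ∀ u v → Dec (Adj u v)
    symAdj  : ∀ {u v} → Adj u v → Adj v u
    irrefl  : ∀ u → ¬ Adj u u
open Graph public

data Walk {m : ℕ} (G : Graph m) : Fin m → Fin m → ℕ → Set where
  nil  : ∀ {u} → Walk G u u zero
  cons : ∀ {u v w k} → Adj G u v → Walk G v w k → Walk G u w (suc k)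

Connected : ∀ {m} → Graph m → Set
Connected G = ∀ u v → ∃ λ k → Walk G u v k

-- d_G(u,v) = k : there is a u-v walk of length k and none shorter.
-- (If no walk exists, the distance is infinite and no k satisfies this.)
Dist : ∀ {m} → Graph m → Fin m → Fin m → ℕ → Set
Dist G u v k = Walk G u v k × (∀ j → j < k → ¬ Walk G u v j)

DistZ : ∀ {m} → Graph m → Fin m → Fin m → ℤ → Set
DistZ G u v d = Σ ℕ λ k → (d ≡ + k) × Dist G u v k

SameEdge : ∀ {m} → Fin m → Fin m → Fin m → Fin m → Set
SameEdge x y u v = ((u ≡ x) × (v ≡ y)) ⊎ ((u ≡ y) × (v ≡ x))

deleteEdge : ∀ {m} → Graph m → Fin m → Fin m → Graph m
deleteEdge {m} G x y = record
  { Adj    = λ u v → Adj G u v × ¬ SameEdge x y u v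
  ; adj?   = dec
  ; symAdj = λ { (a , ne) → symAdj G a , λ s → ne (swap s) }
  ; irrefl = λ u (a , _) → irrefl G u a
  }
  where
  open import Data.Fin.Properties using (_≟_)
  open import Relation.Nullary using (yes; no)
  open import Relation.Nullary.Decidable using (_×-dec_; ¬?; _⊎-dec_)
  open import Data.Sum using (inj₁; inj₂)
  dec : ∀ u v → Dec (Adj G u v × ¬ SameEdge x y u v)
  dec u v = adj? G u v ×-dec ¬? (((u ≟ x) ×-dec (v ≟ y)) ⊎-dec ((u ≟ y) ×-dec (v ≟ x)))
  swap : ∀ {u v} → SameEdge x y v u → SameEdge x y u v
  swap (inj₁ (a , b)) = inj₂ (b , a)
  swap (inj₂ (a , b)) = inj₁ (b , a)

-- A realization (G,W) of S ⊂ ℤ^n, with G on vertex set S: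
-- S is enumerated injectively by s : Fin m → (Fin n → ℤ) (vertex u "is" s u),
-- G is a connected simple graph on these vertices, W = (ω¹,…,ωⁿ) is an ordered
-- set of distinct vertices, and r_G(u | W) = u, i.e. d_G(u, ωⁱ) = uᵢ.
record Realization (n m : ℕ) (s : Fin m → Fin n → ℤ) : Set₁ where
  field
    G         : Graph m
    W         : Fin n → Fin m
    connected : Connected G
    s-inj     : Injective _≡_ _≡_ s
    W-inj     : Injective _≡_ _≡_ W
    rep       : ∀ u i → DistZ G u (W i) (s u i)

-- A shortest walk only uses xy in the
-- direction from the endpoint farther from ωⁱ to the nearer one, say from y
-- to x with xᵢ = yᵢ − 1; there it can be rerouted through another neighbour z
-- of y with zᵢ = xᵢ, and iterating along the walk gives a walk in G − xy of
-- the same length.  Conversely, if distances survive in G − xy, then y has a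
-- neighbour one step closer to ωⁱ in G − xy, which is the required z.
module Submission where

open import Defs
open import Data.Nat using (ℕ; zero; suc; s≤s)
open import Data.Nat.Properties using (<-cmp)
open import Data.Integer using (ℤ; _-_; 1ℤ; +_)
open import Data.Integer.Properties using (+-injective)
open import Data.Fin using (Fin)
open import Data.Fin.Properties using (_≟_)
open import Data.Product using (∃; _×_; _,_)
open import Data.Sum using (inj₁; inj₂)
open import Data.Empty using (⊥-elim)
open import Relation.Nullary using (yes; no; Dec)
open import Relation.Nullary.Decidable using (_×-dec_; _⊎-dec_)
open import Relation.Binary using (tri<; tri≈; tri>)
open import Relation.Binary.PropositionalEquality
  using (_≡_; _≢_; refl; sym; trans; cong; subst)
open import Function.Bundles using (_⇔_; mk⇔)

+m≡+n-1⇒n≡1+m : ∀ {m n} → + m ≡ + n - 1ℤ → n ≡ suc m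
+m≡+n-1⇒n≡1+m {n = zero}  ()
+m≡+n-1⇒n≡1+m {n = suc n} eq = cong suc (sym (+-injective eq))

DistZ⇒Dist : ∀ {m} {H : Graph m} {u t : Fin m} {d : ℤ} {k : ℕ} →
  DistZ H u t d → d ≡ + k → Dist H u t k
DistZ⇒Dist {H = H} {u} {t} (k′ , refl , dist) eq =
  subst (Dist H u t) (+-injective eq) dist

module _ {m} {H : Graph m} {t : Fin m} {f : Fin m → ℤ}
         (dist : ∀ u → DistZ H u t (f u)) where

  descend : ∀ {u k} → f u ≡ + suc k → ∃ λ v → Adj H u v × f v ≡ + k
  descend {u} {k} fu with DistZ⇒Dist (dist u) fu
  ... | cons {v = v} uv w , shortest with dist v
  ...   | kv , fv , wv , shortest-v with <-cmp kv k
  ...     | tri< kv<k _ _ = ⊥-elim (shortest (suc kv) (s≤s kv<k) (cons uv wv))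
  ...     | tri≈ _ refl _ = v , uv , fv
  ...     | tri> _ _ k<kv = ⊥-elim (shortest-v k k<kv w)

  neighbour-one-closer : ∀ {x y} → f x ≡ f y - 1ℤ → ∃ λ z → Adj H y z × f z ≡ f x
  neighbour-one-closer {x} {y} fx≡fy-1 with dist x | dist y
  ... | kx , fx , _ | ky , fy , _ with descend (trans fy (cong +_ ky≡1+kx))
    where
    ky≡1+kx : ky ≡ suc kx
    ky≡1+kx = +m≡+n-1⇒n≡1+m (trans (sym fx) (trans fx≡fy-1 (cong (_- 1ℤ) fy)))
  ... | z , yz , fz = z , yz , trans fz (sym fx)

Walk-deleteEdge⇒Walk : ∀ {m} {G : Graph m} {x y u t k} →
  Walk (deleteEdge G x y) u t k → Walk G u t k
Walk-deleteEdge⇒Walk nil                = nil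
Walk-deleteEdge⇒Walk (cons (uv , _) w) = cons uv (Walk-deleteEdge⇒Walk w)

sameEdge? : ∀ {m} (x y u v : Fin m) → Dec (SameEdge x y u v)
sameEdge? x y u v = ((u ≟ x) ×-dec (v ≟ y)) ⊎-dec ((u ≟ y) ×-dec (v ≟ x))

module _ {m} (G : Graph m) {x y : Fin m} where

  deleteEdge-adjˡ : Adj G x y → ∀ {z} → Adj G x z → z ≢ y → Adj (deleteEdge G x y) x z
  deleteEdge-adjˡ xy xz z≢y = xz , λ
    { (inj₁ (_ , z≡y))  → z≢y z≡y
    ; (inj₂ (x≡y , _)) → irrefl G x (subst (Adj G x) (sym x≡y) xy) }

  deleteEdge-adjʳ : Adj G x y → ∀ {z} → Adj G y z → z ≢ x → Adj (deleteEdge G x y) y z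
  deleteEdge-adjʳ xy yz z≢x = yz , λ
    { (inj₁ (y≡x , _)) → irrefl G x (subst (Adj G x) y≡x xy)
    ; (inj₂ (_ , z≡x))  → z≢x z≡x }

  deleteEdge-adjˡ⁻ : ∀ {z} → Adj (deleteEdge G x y) x z → Adj G x z × z ≢ y
  deleteEdge-adjˡ⁻ (xz , ¬xy) = xz , λ z≡y → ¬xy (inj₁ (refl , z≡y))

  deleteEdge-adjʳ⁻ : ∀ {z} → Adj (deleteEdge G x y) y z → Adj G y z × z ≢ x
  deleteEdge-adjʳ⁻ (yz , ¬xy) = yz , λ z≡x → ¬xy (inj₂ (refl , z≡x))

Detour : ∀ {m} → Graph m → (Fin m → ℤ) → Fin m → Fin m → Set
Detour G f x y = f x ≡ f y - 1ℤ → ∃ λ z → Adj G y z × z ≢ x × f z ≡ f x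

module _ {m} (G : Graph m) {x y t : Fin m} {f : Fin m → ℤ} where

  private
    G′ = deleteEdge G x y

  deleteEdge-dist⇒detourʳ : (∀ u → DistZ G′ u t (f u)) → Detour G f x y
  deleteEdge-dist⇒detourʳ dist′ fx≡fy-1 with neighbour-one-closer dist′ fx≡fy-1
  ... | z , yz , fz with deleteEdge-adjʳ⁻ G yz
  ...   | yz , z≢x = z , yz , z≢x , fz

  deleteEdge-dist⇒detourˡ : (∀ u → DistZ G′ u t (f u)) → Detour G f y x
  deleteEdge-dist⇒detourˡ dist′ fy≡fx-1 with neighbour-one-closer dist′ fy≡fx-1
  ... | z , xz , fz with deleteEdge-adjˡ⁻ G xz
  ...   | xz , z≢y = z , xz , z≢y , fz

  module _ (xy : Adj G x y) (dist : ∀ u → DistZ G u t (f u))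
           (detour-y : Detour G f x y) (detour-x : Detour G f y x) where

    descend-avoiding : ∀ {u k} → f u ≡ + suc k → ∃ λ v → Adj G′ u v × f v ≡ + k
    descend-avoiding {u} {k} fu with descend dist fu
    ... | v , uv , fv with sameEdge? x y u v
    ...   | no ¬xy = v , (uv , ¬xy) , fv
    ...   | yes (inj₁ (refl , refl)) with detour-x (trans fv (cong (_- 1ℤ) (sym fu)))
    ...     | z , xz , z≢y , fz = z , deleteEdge-adjˡ G xy xz z≢y , trans fz fv
    descend-avoiding {u} {k} fu
          | v , uv , fv | yes (inj₂ (refl , refl)) with detour-y (trans fv (cong (_- 1ℤ) (sym fu)))
    ...     | z , yz , z≢x , fz = z , deleteEdge-adjʳ G xy yz z≢x , trans fz fv

    walk-avoiding : ∀ k {u} → f u ≡ + k → Walk G′ u t k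
    walk-avoiding zero {u} fu with DistZ⇒Dist (dist u) fu
    ... | nil , _ = nil
    walk-avoiding (suc k) fu with descend-avoiding fu
    ... | v , uv , fv = cons uv (walk-avoiding k fv)

    detours⇒deleteEdge-dist : ∀ u → DistZ G′ u t (f u)
    detours⇒deleteEdge-dist u with dist u
    ... | k , fu , _ , shortest =
      k , fu , walk-avoiding k fu ,
      λ j j<k w′ → shortest j j<k (Walk-deleteEdge⇒Walk w′)

proposition2p2 : ∀ {n m : ℕ} (s : Fin m → Fin n → ℤ) (R : Realization n m s)
    (x y : Fin m) → Adj (Realization.G R) x y →
    (∀ u i → DistZ (deleteEdge (Realization.G R) x y) u (Realization.W R i) (s u i))
    ⇔
    ((∀ i → s x i ≡ s y i - 1ℤ →
        ∃ λ z → Adj (Realization.G R) y z × z ≢ x × s z i ≡ s x i)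
     × (∀ i → s y i ≡ s x i - 1ℤ →
        ∃ λ z → Adj (Realization.G R) x z × z ≢ y × s z i ≡ s y i))
proposition2p2 s R x y xy = mk⇔
  (λ dist′ → (λ i → deleteEdge-dist⇒detourʳ G (λ u → dist′ u i))
           , (λ i → deleteEdge-dist⇒detourˡ G (λ u → dist′ u i)))
  (λ (detour-y , detour-x) u i →
     detours⇒deleteEdge-dist G xy (λ v → rep v i) (detour-y i) (detour-x i) u)
  where open Realization R
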